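{- Let $\pi^*$ and $\tau$ be chromosomes. Then $\pi^*=\tau$ if and only if $\mathcal{A}[\pi^*]=\mathcal{A}[\tau]$ and there is a bijection $f$ between identical adjacencies of $\mathcal{A}[\pi^*]$ and $\mathcal{A}[\tau]$ such that all cycles of the alternative-cycle graph $ACG(\pi^*,\tau,f)$ are 1-cycles.
   Context: Fix genes $\Sigma_1$ and repeats $\Sigma_2\ni r_0$. A chromosome is a sequence $\pi=[x_0,\dots,x_{n+1}]$ of signed symbols ($x_i=\pm a$, $|x_i|=a$) with $x_0=+r_0$, $x_{n+1}=-r_0$, every gene occurring exactly once. Each occurrence $x_i$ has nodes labelled $l(x_i),r(x_i)$: $(a^h,a^t)$ if $x_i=+a$, $(a^t,a^h)$ if $x_i=-a$. Adjacencies: the unordered pairs $\langle r(x_i),l(x_{i+1})\rangle$ at the gaps $0\le i\le n$; $\mathcal{A}[\pi]$ is their multiset. Alternative-cycle graph $ACG(\pi,\tau,f)$: $f$ is a bijection between the gaps of $\pi$ and of $\tau$ sending each adjacency to an identical one; the left (right) end of $\pi$ is also matched with the left (right) end of $\tau$. For each occurrence $x_i$ of $\pi$ create two distinct nodes $l(x_i),r(x_i)$ joined by a red edge. For each occurrence $y_k$ of $\tau$: among the nodes of $\pi$ bordering the gap matched to the left gap of $y_k$, take the one labelled $l(y_k)$; among those bordering the gap matched to the right gap of $y_k$, take the one labelled $r(y_k)$; join them by a blue edge. The graph is a disjoint union of cycles alternating red and blue edges; a cycle with $c$ blue edges is a $c$-cycle. -}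

module Defs where

open import Data.Nat using (ℕ; zero; suc)
open import Data.Fin using (Fin; zero; suc; inject₁; fromℕ)
open import Data.Vec using (Vec; lookup)
open import Data.List using (List)
import Data.List as List
open import Data.Maybe using (Maybe; just; nothing)
import Data.Maybe as Maybe
open import Data.Product using (Σ; Σ-syntax; _×_; _,_; ∃; ∃-syntax)
open import Data.Sum using (_⊎_; inj₁; inj₂)
import Data.Sum.Properties as SumP
import Data.Product.Properties as ProdP
open import Relation.Binary.PropositionalEquality using (_≡_)
open import Relation.Binary.Definitions using (DecidableEquality)
open import Relation.Nullary using (yes; no)
open import Function.Bundles using (_↔_; Inverse)
open import Data.List.Relation.Binary.Permutation.Homogeneous using (Permutation)

-- Alphabets: genes Σ₁, repeats Σ₂ ∋ r₀ (disjoint), with decidable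
-- equality (needed to "take the node labelled ..." in the ACG).

record Alphabet : Set₁ where
  field
    Gene    : Set
    Repeat  : Set
    _≟G_    : DecidableEquality Gene
    _≟R_    : DecidableEquality Repeat
    r₀      : Repeat

module _ (A : Alphabet) where
  open Alphabet A

  Sym : Set
  Sym = Gene ⊎ Repeat

data Ori : Set where
  ⊕ ⊖ : Ori

record Signed (S : Set) : Set where
  constructor _·_
  field
    ori : Ori
    sym : S
open Signed public

data End : Set where
  hd tl : End

Label : Set → Set
Label S = S × End

l : ∀ {S} → Signed S → Label S
l (⊕ · a) = a , hd
l (⊖ · a) = a , tl

r : ∀ {S} → Signed S → Label S
r (⊕ · a) = a , tl
r (⊖ · a) = a , hd

Seq : Alphabet → Set
Seq A = Σ[ n ∈ ℕ ] Vec (Signed (Sym A)) (suc (suc n))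

IsChromosome : (A : Alphabet) → Seq A → Set
IsChromosome A (n , xs) =
    (lookup xs zero ≡ ⊕ · inj₂ (Alphabet.r₀ A))
  × (lookup xs (fromℕ (suc n)) ≡ ⊖ · inj₂ (Alphabet.r₀ A))
  × (∀ (g : Alphabet.Gene A) →
       Σ[ i ∈ Fin (suc (suc n)) ] (sym (lookup xs i) ≡ inj₁ g
         × (∀ j → sym (lookup xs j) ≡ inj₁ g → j ≡ i)))

-- Adjacencies: unordered pairs ⟨r(x_i), l(x_{i+1})⟩ at gaps 0 ≤ i ≤ n

Adj : Set → Set
Adj S = Label S × Label S

AdjEq : ∀ {S} → Adj S → Adj S → Set
AdjEq (a , b) (c , d) = (a ≡ c × b ≡ d) ⊎ (a ≡ d × b ≡ c)

adj : ∀ A (π : Seq A) → Fin (suc (Data.Product.proj₁ π)) → Adj (Sym A)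
adj A (n , xs) i = r (lookup xs (inject₁ i)) , l (lookup xs (suc i))

-- the multiset 𝒜[π] (as a list, compared up to permutation)
𝒜 : ∀ A (π : Seq A) → List (Adj (Sym A))
𝒜 A π = List.tabulate (adj A π)

_≋_ : ∀ {S} → List (Adj S) → List (Adj S) → Set
_≋_ = Permutation AdjEq

AdjBij : ∀ A (π τ : Seq A) → Set
AdjBij A π τ = Σ[ f ∈ Fin (suc (Data.Product.proj₁ π)) ↔ Fin (suc (Data.Product.proj₁ τ)) ]
               (∀ i → AdjEq (adj A π i) (adj A τ (Inverse.to f i)))

data Side : Set where
  L R : Side

-- nodes of the ACG: l(x_i) = (i , L), r(x_i) = (i , R)
Node : ∀ A → Seq A → Set
Node A (n , _) = Fin (suc (suc n)) × Side

nodeLabel : ∀ A (π : Seq A) → Node A π → Label (Sym A)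
nodeLabel A (n , xs) (i , L) = l (lookup xs i)
nodeLabel A (n , xs) (i , R) = r (lookup xs i)

_≟Lab_ : ∀ {A : Alphabet} → DecidableEquality (Label (Sym A))
_≟Lab_ {A} = ProdP.≡-dec (SumP.≡-dec (Alphabet._≟G_ A) (Alphabet._≟R_ A))
                           decEnd
  where
  decEnd : DecidableEquality End
  decEnd hd hd = yes _≡_.refl
  decEnd hd tl = no (λ ())
  decEnd tl hd = no (λ ())
  decEnd tl tl = yes _≡_.refl

-- the paper gap immediately right of occurrence k (nothing for the last
-- occurrence, whose right gap is the right end)
rightGap : ∀ {m} → Fin (suc m) → Maybe (Fin m)
rightGap {zero}  zero    = nothing
rightGap {suc m} zero    = just zero
rightGap {suc m} (suc k) = Maybe.map suc (rightGap k)

module ACG (A : Alphabet) (π τ : Seq A) (f : AdjBij A π τ) where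
  n m : ℕ
  n = Data.Product.proj₁ π
  m = Data.Product.proj₁ τ
  ys = Data.Product.proj₂ τ

  g : Fin (suc m) → Fin (suc n)
  g k = Inverse.from (Data.Product.proj₁ f) k

  -- The nodes of π bordering π-gap j are r(x_j) = (inject₁ j , R) and
  -- l(x_{j+1}) = (suc j , L).  We take the one with the requested label;
  -- if both carry it, the one on the same side as in τ.
  pickL : Fin (suc n) → Label (Sym A) → Node A π
  pickL j lab with _≟Lab_ {A} (nodeLabel A π (suc j , L)) lab
  ... | yes _ = suc j , L
  ... | no  _ = inject₁ j , R

  pickR : Fin (suc n) → Label (Sym A) → Node A π
  pickR j lab with _≟Lab_ {A} (nodeLabel A π (inject₁ j , R)) lab
  ... | yes _ = inject₁ j , R
  ... | no  _ = suc j , L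

  -- endpoint for l(y_k): left gap of y_k (left end ↦ left end of π)
  blueL : Fin (suc (suc m)) → Node A π
  blueL zero    = zero , L
  blueL (suc k) = pickL (g k) (l (lookup ys (suc k)))

  -- endpoint for r(y_k): right gap of y_k (right end ↦ right end of π)
  blueR : Fin (suc (suc m)) → Node A π
  blueR k with rightGap k
  ... | nothing = fromℕ (suc n) , R
  ... | just k′ = pickR (g k′) (r (lookup ys k))

  -- red edges join (i , L) and (i , R); the blue edge of y_k joins
  -- blueL k and blueR k.  The cycle through the blue edge of y_k is a
  -- 1-cycle (exactly one blue edge, hence exactly one red edge) iff the
  -- blue edge joins the two endpoints of a single red edge.
  BlueInOneCycle : Fin (suc (suc m)) → Set
  BlueInOneCycle k = Σ[ i ∈ Fin (suc (suc n)) ]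
      ((blueL k ≡ (i , L) × blueR k ≡ (i , R))
     ⊎ (blueL k ≡ (i , R) × blueR k ≡ (i , L)))

  -- every cycle contains a blue edge, so: all cycles are 1-cycles
  AllOneCycles : Set
  AllOneCycles = ∀ k → BlueInOneCycle k

AllCyclesAre1Cycles : ∀ A (π τ : Seq A) → AdjBij A π τ → Set
AllCyclesAre1Cycles A π τ f = ACG.AllOneCycles A π τ f

{-# OPTIONS --safe #-}

-- If every cycle is a 1-cycle, every blue edge of τ doubles a red edge of π*.
-- Follow the gap bijection f along τ: the blue edge of y₀ forces f(0) = 0, and
-- the blue edge of each interior yₖ forces the π*-gaps matched to its two
-- sides to be neighbours, and an ascent forces l(yₖ) to be the label of the
-- occurrence between them.  An injective walk on ℕ that starts at 0 and
-- moves by ±1 can never descend, so f is the identity and π* agrees with τ at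
-- every interior occurrence, while the two ends are +r₀ and −r₀ in both.
module Submission where

open import Defs
open import Data.Product using (Σ-syntax; _×_)
open import Relation.Binary.PropositionalEquality using (_≡_)
open import Function.Bundles using (_⇔_)

open import Data.Nat as ℕ using (ℕ; zero; suc)
import Data.Nat.Properties as ℕ
open import Data.Fin using (Fin; zero; suc; inject₁; fromℕ; fromℕ<; toℕ; _≤_)
open import Data.Fin.Properties
  using (toℕ-injective; toℕ-inject₁; toℕ-fromℕ<; toℕ<n; ≤̄⇒inject₁<; <⇒≤pred)
open import Data.Fin.Induction using (<-weakInduction)
open import Data.Fin.Permutation using (↔⇒≡)
open import Data.Maybe using (just; nothing)
open import Data.List using (List)
open import Data.Vec using (Vec; lookup)
open import Data.Vec.Relation.Binary.Pointwise.Extensional using (ext; Pointwise-≡⇒≡)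
open import Data.Product using (_,_; proj₁)
open import Data.Sum using (_⊎_; inj₁; inj₂; map₁)
open import Function using (_∘_)
open import Function.Bundles using (Inverse; mk⇔)
open import Function.Properties.Inverse using (↔-refl)
open import Relation.Binary.PropositionalEquality
  using (refl; trans; cong; subst; module ≡-Reasoning)
import Relation.Binary.PropositionalEquality as ≡
open import Relation.Nullary using (yes; no; contradiction)
import Data.List.Relation.Binary.Permutation.Homogeneous as Permutation
import Data.List.Relation.Binary.Pointwise as Pointwise

data LastOrInject₁ : ∀ {n} → Fin (suc n) → Set where
  last   : ∀ {n} → LastOrInject₁ (fromℕ n)
  inject : ∀ {n} (j : Fin n) → LastOrInject₁ (inject₁ j)

lastOrInject₁ : ∀ {n} (k : Fin (suc n)) → LastOrInject₁ k
lastOrInject₁ {zero}  zero    = last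
lastOrInject₁ {suc n} zero    = inject zero
lastOrInject₁ {suc n} (suc k) with lastOrInject₁ k
... | last     = last
... | inject j = inject (suc j)

rightGap-inject₁ : ∀ {m} (j : Fin (suc m)) → rightGap (inject₁ j) ≡ just j
rightGap-inject₁ {zero}  zero    = refl
rightGap-inject₁ {suc m} zero    = refl
rightGap-inject₁ {suc m} (suc j) rewrite rightGap-inject₁ j = refl

rightGap-fromℕ : ∀ m → rightGap (fromℕ m) ≡ nothing
rightGap-fromℕ zero    = refl
rightGap-fromℕ (suc m) rewrite rightGap-fromℕ m = refl

l-injective : ∀ {S} {x y : Signed S} → l x ≡ l y → x ≡ y
l-injective {x = ⊕ · _} {⊕ · _} refl = refl
l-injective {x = ⊖ · _} {⊖ · _} refl = refl

module _ {n} (h : Fin (suc n) → ℕ) (h-injective : ∀ {a b} → h a ≡ h b → a ≡ b) where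

  FixedUpTo : Fin (suc n) → Set
  FixedUpTo a = ∀ b → b ≤ a → h b ≡ toℕ b

  -- h takes every value 0, …, toℕ a on [0, a], so injectivity puts any
  -- preimage of such a value there.
  FixedUpTo⇒≤ : ∀ {a x} → FixedUpTo a → h x ℕ.≤ toℕ a → x ≤ a
  FixedUpTo⇒≤ {a} {x} fixed hx≤a = subst (_≤ a) (h-injective hb≡hx) b≤a
    where
    hx<1+n : h x ℕ.< suc n
    hx<1+n = ℕ.≤-<-trans hx≤a (toℕ<n a)
    b : Fin (suc n)
    b = fromℕ< hx<1+n
    b≤a : b ≤ a
    b≤a = subst (ℕ._≤ toℕ a) (≡.sym (toℕ-fromℕ< hx<1+n)) hx≤a
    hb≡hx : h b ≡ h x
    hb≡hx = trans (fixed b b≤a) (toℕ-fromℕ< hx<1+n)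

  unitStepWalk⇒≡toℕ :
    h zero ≡ 0 →
    (∀ j → h (suc j) ≡ suc (h (inject₁ j)) ⊎ suc (h (suc j)) ≡ h (inject₁ j)) →
    ∀ a → h a ≡ toℕ a
  unitStepWalk⇒≡toℕ h₀ step a = <-weakInduction FixedUpTo fixed₀ extend a a ℕ.≤-refl
    where
    fixed₀ : FixedUpTo zero
    fixed₀ zero _ = h₀

    extend : ∀ j → FixedUpTo (inject₁ j) → FixedUpTo (suc j)
    extend j fixed = fixedUpToSuc
      where
      h[inject₁j] : h (inject₁ j) ≡ toℕ j
      h[inject₁j] = trans (fixed (inject₁ j) ℕ.≤-refl) (toℕ-inject₁ j)

      h[sucj] : h (suc j) ≡ suc (toℕ j)
      h[sucj] with step j
      ... | inj₁ ascent  = trans ascent (cong suc h[inject₁j])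
      ... | inj₂ descent = contradiction (FixedUpTo⇒≤ fixed below) (ℕ.<⇒≱ (≤̄⇒inject₁< ℕ.≤-refl))
        where
        below : h (suc j) ℕ.≤ toℕ (inject₁ j)
        below = ℕ.<⇒≤ (subst (h (suc j) ℕ.<_) (trans descent (fixed (inject₁ j) ℕ.≤-refl)) ℕ.≤-refl)

      fixedUpToSuc : FixedUpTo (suc j)
      fixedUpToSuc b b≤sucj with ℕ.m≤n⇒m<n∨m≡n b≤sucj
      ... | inj₁ b<sucj = fixed b (<⇒≤pred b<sucj)
      ... | inj₂ b≡sucj rewrite toℕ-injective {j = suc j} b≡sucj = h[sucj]

opposite : ∀ {N : Set} → N × Side → N × Side
opposite (i , L) = i , R
opposite (i , R) = i , L

redEdge⇒opposite : ∀ {N : Set} {u v : N × Side} →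
  Σ[ i ∈ N ] ((u ≡ (i , L) × v ≡ (i , R)) ⊎ (u ≡ (i , R) × v ≡ (i , L))) →
  v ≡ opposite u
redEdge⇒opposite (_ , inj₁ (refl , refl)) = refl
redEdge⇒opposite (_ , inj₂ (refl , refl)) = refl

module ACG-Endpoints (A : Alphabet) {n m : ℕ}
         (xs : Vec (Signed (Sym A)) (suc (suc n))) (ys : Vec (Signed (Sym A)) (suc (suc m)))
         (f : AdjBij A (n , xs) (m , ys)) where
  open ACG A (n , xs) (m , ys) f using (g; pickL; pickR; blueR)

  pickL-self : ∀ j → pickL j (l (lookup xs (suc j))) ≡ (suc j , L)
  pickL-self j with _≟Lab_ {A} (l (lookup xs (suc j))) (l (lookup xs (suc j)))
  ... | yes _ = refl
  ... | no ≢  = contradiction refl ≢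

  pickR-self : ∀ j → pickR j (r (lookup xs (inject₁ j))) ≡ (inject₁ j , R)
  pickR-self j with _≟Lab_ {A} (r (lookup xs (inject₁ j))) (r (lookup xs (inject₁ j)))
  ... | yes _ = refl
  ... | no ≢  = contradiction refl ≢

  pickR≡R : ∀ {j lab i} → pickR j lab ≡ (i , R) → inject₁ j ≡ i
  pickR≡R {j} {lab} e with _≟Lab_ {A} (r (lookup xs (inject₁ j))) lab
  pickR≡R e  | yes _ = cong proj₁ e
  pickR≡R () | no _

  pickR≡opposite-pickL : ∀ {a b labL labR} → pickR b labR ≡ opposite (pickL a labL) →
    (inject₁ b ≡ suc a × l (lookup xs (suc a)) ≡ labL) ⊎ suc b ≡ inject₁ a
  pickR≡opposite-pickL {a} {b} {labL} {labR} e
    with _≟Lab_ {A} (l (lookup xs (suc a))) labL | _≟Lab_ {A} (r (lookup xs (inject₁ b))) labR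
  pickR≡opposite-pickL e  | yes labL≡ | yes _ = inj₁ (cong proj₁ e , labL≡)
  pickR≡opposite-pickL () | yes _     | no _
  pickR≡opposite-pickL () | no _      | yes _
  pickR≡opposite-pickL e  | no _      | no _  = inj₂ (cong proj₁ e)

  blueR-inject₁ : ∀ j → blueR (inject₁ j) ≡ pickR (g j) (r (lookup ys (inject₁ j)))
  blueR-inject₁ j rewrite rightGap-inject₁ j = refl

  blueR-last : blueR (fromℕ (suc m)) ≡ (fromℕ (suc n) , R)
  blueR-last rewrite rightGap-fromℕ (suc m) = refl

module ACG-1-Cycles (A : Alphabet) {n : ℕ} (xs ys : Vec (Signed (Sym A)) (suc (suc n)))
         (f : AdjBij A (n , xs) (n , ys))
         (oneCycles : AllCyclesAre1Cycles A (n , xs) (n , ys) f) where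
  open ACG A (n , xs) (n , ys) f using (g; blueL; blueR)
  open Inverse (proj₁ f) using (to; strictlyInverseˡ)
  open ACG-Endpoints A xs ys f using (pickR≡R; pickR≡opposite-pickL; blueR-inject₁)

  g-injective : ∀ {a b} → g a ≡ g b → a ≡ b
  g-injective {a} {b} ga≡gb = begin
    a          ≡⟨ strictlyInverseˡ a ⟨
    to (g a)   ≡⟨ cong to ga≡gb ⟩
    to (g b)   ≡⟨ strictlyInverseˡ b ⟩
    b          ∎
    where open ≡-Reasoning

  blueR≡opposite-blueL : ∀ k → blueR k ≡ opposite (blueL k)
  blueR≡opposite-blueL k = redEdge⇒opposite (oneCycles k)

  g-zero : toℕ (g zero) ≡ 0
  g-zero = trans (≡.sym (toℕ-inject₁ (g zero)))
                 (cong toℕ (pickR≡R (blueR≡opposite-blueL zero)))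

  g-step : ∀ j →
      (toℕ (g (suc j)) ≡ suc (toℕ (g (inject₁ j)))
        × l (lookup xs (suc (g (inject₁ j)))) ≡ l (lookup ys (suc (inject₁ j))))
    ⊎ suc (toℕ (g (suc j))) ≡ toℕ (g (inject₁ j))
  g-step j with pickR≡opposite-pickL
                  (trans (≡.sym (blueR-inject₁ (suc j))) (blueR≡opposite-blueL (suc (inject₁ j))))
  ... | inj₁ (ascent , label) = inj₁ (trans (≡.sym (toℕ-inject₁ _)) (cong toℕ ascent) , label)
  ... | inj₂ descent          = inj₂ (trans (cong toℕ descent) (toℕ-inject₁ _))

  toℕ-g : ∀ k → toℕ (g k) ≡ toℕ k
  toℕ-g = unitStepWalk⇒≡toℕ (toℕ ∘ g) (g-injective ∘ toℕ-injective) g-zero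
            (map₁ proj₁ ∘ g-step)

  lookup-interior : ∀ j → lookup xs (suc (inject₁ j)) ≡ lookup ys (suc (inject₁ j))
  lookup-interior j with g-step j
  ... | inj₁ (_ , label) =
        l-injective (subst (λ a → l (lookup xs (suc a)) ≡ _) (toℕ-injective (toℕ-g (inject₁ j))) label)
  ... | inj₂ descent = contradiction (≡.sym 2+j≡j) (ℕ.m≢1+n+m (toℕ j) {1})
    where
    open ≡-Reasoning
    2+j≡j : suc (suc (toℕ j)) ≡ toℕ j
    2+j≡j = begin
      suc (toℕ (suc j))         ≡⟨ cong suc (toℕ-g (suc j)) ⟨
      suc (toℕ (g (suc j)))     ≡⟨ descent ⟩
      toℕ (g (inject₁ j))       ≡⟨ toℕ-g (inject₁ j) ⟩
      toℕ (inject₁ j)           ≡⟨ toℕ-inject₁ j ⟩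
      toℕ j                     ∎

1-cycles⇒≡ : ∀ A (π τ : Seq A) → IsChromosome A π → IsChromosome A τ →
  (f : AdjBij A π τ) → AllCyclesAre1Cycles A π τ f → π ≡ τ
1-cycles⇒≡ A (n , xs) (m , ys) (x₀ , xₙ₊₁ , _) (y₀ , yₙ₊₁ , _) f oneCycles
  with ↔⇒≡ (proj₁ f)
... | refl = cong (n ,_) (Pointwise-≡⇒≡ (ext lookup-agrees))
  where
  open ACG-1-Cycles A xs ys f oneCycles using (lookup-interior)

  lookup-agrees : ∀ k → lookup xs k ≡ lookup ys k
  lookup-agrees zero = trans x₀ (≡.sym y₀)
  lookup-agrees (suc k) with lastOrInject₁ k
  ... | last     = trans xₙ₊₁ (≡.sym yₙ₊₁)
  ... | inject j = lookup-interior j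

identityAdjBij : ∀ A (π : Seq A) → AdjBij A π π
identityAdjBij A π = ↔-refl , λ _ → inj₁ (refl , refl)

identity-1-cycles : ∀ A (π : Seq A) → AllCyclesAre1Cycles A π π (identityAdjBij A π)
identity-1-cycles A (n , xs) k = k , inj₁ (blueL≡ k , blueR≡ k)
  where
  open ACG A (n , xs) (n , xs) (identityAdjBij A (n , xs)) using (blueL; blueR)
  open ACG-Endpoints A xs xs (identityAdjBij A (n , xs))

  blueL≡ : ∀ k → blueL k ≡ (k , L)
  blueL≡ zero    = refl
  blueL≡ (suc k) = pickL-self k

  blueR≡ : ∀ k → blueR k ≡ (k , R)
  blueR≡ k with lastOrInject₁ k
  ... | last     = blueR-last
  ... | inject j = trans (blueR-inject₁ j) (pickR-self j)

≋-refl : ∀ {S} (as : List (Adj S)) → as ≋ as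
≋-refl _ = Permutation.refl (Pointwise.refl (inj₁ (refl , refl)))

theorem8 : (A : Alphabet) (π τ : Seq A) →
    IsChromosome A π → IsChromosome A τ →
    (π ≡ τ) ⇔ ((𝒜 A π ≋ 𝒜 A τ) × (Σ[ f ∈ AdjBij A π τ ] AllCyclesAre1Cycles A π τ f))
theorem8 A π τ cπ cτ = mk⇔ ≡⇒conditions conditions⇒≡
  where
  ≡⇒conditions : π ≡ τ → (𝒜 A π ≋ 𝒜 A τ) × (Σ[ f ∈ AdjBij A π τ ] AllCyclesAre1Cycles A π τ f)
  ≡⇒conditions refl = ≋-refl (𝒜 A π) , identityAdjBij A π , identity-1-cycles A π

  conditions⇒≡ : (𝒜 A π ≋ 𝒜 A τ) × (Σ[ f ∈ AdjBij A π τ ] AllCyclesAre1Cycles A π τ f) → π ≡ τ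
  -- 𝒜[π*] = 𝒜[τ] already follows from the existence of f.
  conditions⇒≡ (_ , f , oneCycles) = 1-cycles⇒≡ A π τ cπ cτ f oneCycles
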